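{- For every odd integer $m\geq 3$ there exists a $3$-SCHGDD of type $(6,m^3)$.
   Context: Let $n,m,t$ be positive integers, $I_n=\{0,1,\dots,n-1\}$, $Z_{mt}$ the integers modulo $mt$, and $S=\{0,t,2t,\dots,(m-1)t\}\subseteq Z_{mt}$. A $3$-HGDD of type $(n,m^t)$ is a quadruple $(X,\mathcal G,\mathcal H,\mathcal B)$ where $X$ is a set of $nmt$ points, $\mathcal G$ is a partition of $X$ into $n$ groups of size $mt$, $\mathcal H$ is a partition of $X$ into $t$ holes of size $nm$ with $|H\cap G|=m$ for every $H\in\mathcal H$, $G\in\mathcal G$, and $\mathcal B$ is a collection of $3$-subsets of $X$ (blocks) such that no block contains two distinct points of the same group or of the same hole, while every other pair of distinct points of $X$ lies in exactly one block. A $3$-SCHGDD of type $(n,m^t)$ is a $3$-HGDD of type $(n,m^t)$ which, up to isomorphism, has $X=I_n\times Z_{mt}$, groups $\{i\}\times Z_{mt}$ ($i\in I_n$), holes $I_n\times(S+l)$ ($0\le l\le t-1$), and block set invariant under $(i,x)\mapsto (i,x+1 \bmod mt)$. -}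

module Defs where

open import Data.Nat using (ℕ; suc; _+_; _*_; _%_; NonZero)
open import Data.Nat.DivMod using (_mod_)
open import Data.Fin using (Fin; toℕ)
open import Data.Product using (_×_; _,_; proj₁; proj₂; ∃; ∃!)
open import Data.List using (List; length; map; lookup)
open import Data.List.Relation.Unary.All using (All)
open import Data.List.Relation.Unary.Unique.Propositional using (Unique)
open import Data.List.Membership.Propositional using (_∈_)
open import Data.List.Relation.Binary.Permutation.Propositional using (_↭_)
open import Relation.Nullary using (¬_)
open import Relation.Binary.PropositionalEquality using (_≡_; _≢_)

Point : ℕ → ℕ → Set
Point n mt = Fin n × Fin mt

-- A block is a list of points (read as the set of its entries).
Block : ℕ → ℕ → Set
Block n mt = List (Point n mt)

SameGroup : ∀ {n mt} → Point n mt → Point n mt → Set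
SameGroup p q = proj₁ p ≡ proj₁ q

-- Holes are I_n × (S + l) with S = {0, t, …, (m-1)t}; (i , x) lies in
-- hole l = x mod t.  Same hole iff residues mod t agree.
SameHole : ∀ {n mt} (t : ℕ) .{{_ : NonZero t}} → Point n mt → Point n mt → Set
SameHole t p q = toℕ (proj₂ p) % t ≡ toℕ (proj₂ q) % t

next : ∀ {k} → Fin k → Fin k
next {suc k} x = suc (toℕ x) mod suc k

shift : ∀ {n mt} → Point n mt → Point n mt
shift (i , x) = i , next x

-- (I_n × Z_{mt}, groups, holes, B) is a 3-HGDD of type (n, m^t), where B is
-- a list of blocks (the list positions index the collection of blocks).
record Is3HGDD (n m t : ℕ) .{{_ : NonZero t}} (B : List (Block n (m * t))) : Set where
  field
    blockSize   : All (λ b → length b ≡ 3) B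
    blockDistinct : All Unique B
    noGroupPair : All (λ b → ∀ {p q} → p ∈ b → q ∈ b → p ≢ q → ¬ SameGroup p q) B
    noHolePair  : All (λ b → ∀ {p q} → p ∈ b → q ∈ b → p ≢ q → ¬ SameHole t p q) B
    cover : ∀ (p q : Point n (m * t)) → p ≢ q → ¬ SameGroup p q → ¬ SameHole t p q →
            ∃! _≡_ (λ (k : Fin (length B)) → p ∈ lookup B k × q ∈ lookup B k)

record Is3SCHGDD (n m t : ℕ) .{{_ : NonZero t}}
                 (B : List (Block n (m * t))) : Set where
  field
    hgdd      : Is3HGDD n m t B
    invariant : All (λ b → ∃ (λ b′ → b′ ∈ B × map shift b ↭ b′)) B

record Exists3SCHGDD (n m t : ℕ) .{{_ : NonZero t}} : Set where
  field
    blocks   : List (Block n (m * t))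
    isSCHGDD : Is3SCHGDD n m t blocks

module Submission where

-- Points are I_n × ℤ_{3m}; holes are residues mod 3.  A base triangle whose arcs have
-- lengths ≡ 1 (mod 3) has its corners in three different holes.  If every triple
-- (group a, group a′ ≠ a, length 1 + 3e with e < m) lies on exactly one arc of a
-- family of base triangles (a starter), the translates of the triangles by ℤ_{3m}
-- form a 3-SCHGDD of type (n, m^3): of two points in different groups and holes one
-- is a hole after the other, and that arc pins down the unique covering translate
-- (module Development, for any n; it rests on arithmetic in ℤ_N and enumerations).
-- For m = 2k + 1 the groups are ∞ and ℤ_5, with six families of ℤ_5-rotated triangles
-- (module Construction): the arcs of each rotation class of group pairs tile [0, m)
-- (module Tiling), and an affine permutation of ℤ_m turns positions into labels that
-- sum to −1 on every triangle.  Facts about the finitely many rotated shapes are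
-- checked exhaustively; lemma3p7 closes the file.

open import Defs
open import Data.Nat using (ℕ; zero; suc; s≤s; z≤n; _+_; _*_; _∸_; _<_; _≤_; _<?_; _%_; NonZero; >-nonZero⁻¹)
open import Data.Nat.Properties
open import Data.Nat.DivMod
  using (_mod_; _/_; m%n<n; m%n≤n; m%n%n≡m%n; m*n%n≡0; m<n⇒m%n≡m; [m+kn]%n≡m%n; m≡m%n+[m/n]*n;
         %-distribˡ-+; %-distribˡ-*; m∣n⇒o%n%m≡o%m; +-distrib-/-∣ʳ; m*n/n≡m)
open import Data.Nat.Divisibility using (_∣_; divides; m%n≡0⇒n∣m)
open import Data.Nat.Tactic.RingSolver using (solve-∀)
open import Data.Fin using (Fin; zero; suc; toℕ; fromℕ<)
open import Data.Fin.Patterns using (0F; 1F; 2F)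
import Data.Fin.Properties as Fin
open import Data.Vec using (Vec; []; _∷_) renaming (lookup to at)
open import Data.Maybe using (Maybe; just; nothing; maybe′)
import Data.Maybe as Maybe
import Data.Maybe.Properties as Maybe
open import Data.Product using (Σ; ∃; ∃-syntax; ∃!; _×_; _,_; proj₁; proj₂)
import Data.Product.Properties as Product
open import Data.Sum using (_⊎_; inj₁; inj₂)
open import Data.List using (List; []; _∷_; _++_; map; lookup; length; cartesianProduct; allFin)
open import Data.List.Properties using (∷-injectiveˡ; ∷-injectiveʳ)
open import Data.List.Relation.Unary.All as All using (All; []; _∷_)
import Data.List.Relation.Unary.All.Properties as All
open import Data.List.Relation.Unary.AllPairs using ([]; _∷_)
open import Data.List.Relation.Unary.Any using (here; there; index)
open import Data.List.Relation.Unary.Any.Properties using (lookup-index)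
open import Data.List.Relation.Unary.Unique.Propositional using (Unique)
import Data.List.Relation.Unary.Unique.Propositional.Properties as Unique
open import Data.List.Membership.Propositional using (_∈_)
open import Data.List.Membership.Propositional.Properties
  using (∈-map⁺; ∈-map⁻; ∈-++⁺ˡ; ∈-++⁺ʳ; ∈-++⁻; ∈-allFin; ∈-cartesianProduct⁺; ∈-lookup)
open import Data.List.Relation.Binary.Permutation.Propositional using (_↭_; ↭-reflexive)
open import Data.Empty using (⊥; ⊥-elim)
import Data.Empty.Irrelevant as Irrelevant
open import Function using (_∘_)
open import Level using (0ℓ)
open import Relation.Nullary using (¬_; Dec; yes; no)
open import Relation.Nullary.Decidable using (map′; from-yes; ¬?; _⊎-dec_)
open import Relation.Binary.Bundles using (Setoid)
open import Relation.Binary.PropositionalEquality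
  using (_≡_; _≢_; refl; sym; trans; cong; cong₂; subst; module ≡-Reasoning)

module Congruence (N : ℕ) .{{_ : NonZero N}} where

  infix 4 _≈_

  -- Congruence modulo N (a record, so that its two sides can be inferred).
  record _≈_ (a b : ℕ) : Set where
    constructor mod≡
    field mod-≡ : a % N ≡ b % N

  open _≈_ public

  ≡⇒≈ : ∀ {a b} → a ≡ b → a ≈ b
  ≡⇒≈ a≡b = mod≡ (cong (_% N) a≡b)

  ≈-sym : ∀ {a b} → a ≈ b → b ≈ a
  ≈-sym (mod≡ p) = mod≡ (sym p)

  ≈-trans : ∀ {a b c} → a ≈ b → b ≈ c → a ≈ c
  ≈-trans (mod≡ p) (mod≡ q) = mod≡ (trans p q)

  ≈-setoid : Setoid 0ℓ 0ℓ
  ≈-setoid = record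
    { Carrier = ℕ ; _≈_ = _≈_
    ; isEquivalence = record { refl = ≡⇒≈ refl ; sym = ≈-sym ; trans = ≈-trans } }

  %-≈ : ∀ a → a % N ≈ a
  %-≈ a = mod≡ (m%n%n≡m%n a N)

  +-≈ : ∀ {a a′ b b′} → a ≈ a′ → b ≈ b′ → a + b ≈ a′ + b′
  +-≈ {a} {a′} {b} {b′} (mod≡ p) (mod≡ q) = mod≡ (begin
    (a + b) % N              ≡⟨ %-distribˡ-+ a b N ⟩
    (a % N + b % N) % N      ≡⟨ cong₂ (λ u v → (u + v) % N) p q ⟩
    (a′ % N + b′ % N) % N    ≡⟨ %-distribˡ-+ a′ b′ N ⟨
    (a′ + b′) % N            ∎)
    where open ≡-Reasoning

  +-≈ʳ : ∀ a {b b′} → b ≈ b′ → a + b ≈ a + b′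
  +-≈ʳ a = +-≈ (≡⇒≈ {a} refl)

  +-≈ˡ : ∀ {a a′} b → a ≈ a′ → a + b ≈ a′ + b
  +-≈ˡ b p = +-≈ p (≡⇒≈ {b} refl)

  *-≈ : ∀ {a a′ b b′} → a ≈ a′ → b ≈ b′ → a * b ≈ a′ * b′
  *-≈ {a} {a′} {b} {b′} (mod≡ p) (mod≡ q) = mod≡ (begin
    (a * b) % N              ≡⟨ %-distribˡ-* a b N ⟩
    (a % N * (b % N)) % N    ≡⟨ cong₂ (λ u v → (u * v) % N) p q ⟩
    (a′ % N * (b′ % N)) % N  ≡⟨ %-distribˡ-* a′ b′ N ⟨
    (a′ * b′) % N            ∎)
    where open ≡-Reasoning

  *-≈ʳ : ∀ a {b b′} → b ≈ b′ → a * b ≈ a * b′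
  *-≈ʳ a = *-≈ (≡⇒≈ {a} refl)

  *-≈ˡ : ∀ {a a′} b → a ≈ a′ → a * b ≈ a′ * b
  *-≈ˡ b p = *-≈ p (≡⇒≈ {b} refl)

  ≈-divisor : ∀ d .{{_ : NonZero d}} → d ∣ N → ∀ {a b} → a ≈ b → a % d ≡ b % d
  ≈-divisor d d∣N {a} {b} (mod≡ p) = begin
    a % d          ≡⟨ m∣n⇒o%n%m≡o%m d N a d∣N ⟨
    a % N % d      ≡⟨ cong (_% d) p ⟩
    b % N % d      ≡⟨ m∣n⇒o%n%m≡o%m d N b d∣N ⟩
    b % d          ∎
    where open ≡-Reasoning

  ≈-canonical : ∀ {a b} → a < N → b < N → a ≈ b → a ≡ b
  ≈-canonical a<N b<N (mod≡ p) = trans (sym (m<n⇒m%n≡m a<N)) (trans p (m<n⇒m%n≡m b<N))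

  multiple-≈0 : ∀ q → q * N ≈ 0
  multiple-≈0 q = mod≡ (trans (m*n%n≡0 q N) (sym (m<n⇒m%n≡m (>-nonZero⁻¹ N))))

  neg : ℕ → ℕ
  neg a = N ∸ a % N

  +-neg : ∀ a → a + neg a ≈ 0
  +-neg a = begin
    a + neg a          ≈⟨ +-≈ˡ (neg a) (%-≈ a) ⟨
    a % N + neg a      ≡⟨ m+[n∸m]≡n (m%n≤n a N) ⟩
    N                  ≡⟨ *-identityˡ N ⟨
    1 * N              ≈⟨ multiple-≈0 1 ⟩
    0                  ∎
    where open import Relation.Binary.Reasoning.Setoid ≈-setoid

  +-neg-inverseʳ : ∀ a d → a + d + neg d ≈ a
  +-neg-inverseʳ a d = begin
    a + d + neg d      ≡⟨ +-assoc a d (neg d) ⟩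
    a + (d + neg d)    ≈⟨ +-≈ʳ a (+-neg d) ⟩
    a + 0              ≡⟨ +-identityʳ a ⟩
    a                  ∎
    where open import Relation.Binary.Reasoning.Setoid ≈-setoid

  +-neg-inverseˡ : ∀ a d → a + neg d + d ≈ a
  +-neg-inverseˡ a d = begin
    a + neg d + d      ≡⟨ +-assoc a (neg d) d ⟩
    a + (neg d + d)    ≡⟨ cong (a +_) (+-comm (neg d) d) ⟩
    a + (d + neg d)    ≡⟨ +-assoc a d (neg d) ⟨
    a + d + neg d      ≈⟨ +-neg-inverseʳ a d ⟩
    a                  ∎
    where open import Relation.Binary.Reasoning.Setoid ≈-setoid

  +-cancelʳ-≈ : ∀ {a b} c → a + c ≈ b + c → a ≈ b
  +-cancelʳ-≈ {a} {b} c p = begin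
    a                  ≈⟨ +-neg-inverseʳ a c ⟨
    a + c + neg c      ≈⟨ +-≈ˡ (neg c) p ⟩
    b + c + neg c      ≈⟨ +-neg-inverseʳ b c ⟩
    b                  ∎
    where open import Relation.Binary.Reasoning.Setoid ≈-setoid

  module Affine (α σ τ : ℕ) (στ≈1 : σ * τ ≈ 1) where

    apply : ℕ → ℕ
    apply c = (α + σ * c) % N

    unapply : ℕ → ℕ
    unapply e = (τ * (e + neg α)) % N

    unapply-apply : ∀ {c} → c < N → unapply (apply c) ≡ c
    unapply-apply {c} c<N = ≈-canonical (m%n<n _ N) c<N (begin
      τ * (apply c + neg α) % N         ≈⟨ %-≈ _ ⟩
      τ * (apply c + neg α)             ≈⟨ *-≈ʳ τ (+-≈ˡ (neg α) (%-≈ (α + σ * c))) ⟩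
      τ * (α + σ * c + neg α)           ≡⟨ regroup τ α (σ * c) (neg α) ⟩
      τ * (σ * c) + τ * (α + neg α)     ≈⟨ +-≈ʳ (τ * (σ * c)) (*-≈ʳ τ (+-neg α)) ⟩
      τ * (σ * c) + τ * 0               ≡⟨ drop-zero τ σ c ⟩
      σ * τ * c                         ≈⟨ *-≈ˡ c στ≈1 ⟩
      1 * c                             ≡⟨ *-identityˡ c ⟩
      c                                 ∎)
      where
      open import Relation.Binary.Reasoning.Setoid ≈-setoid
      regroup : ∀ t a b n → t * (a + b + n) ≡ t * b + t * (a + n)
      regroup = solve-∀
      drop-zero : ∀ t s c → t * (s * c) + t * 0 ≡ s * t * c
      drop-zero = solve-∀

    apply-unapply : ∀ {e} → e < N → apply (unapply e) ≡ e
    apply-unapply {e} e<N = ≈-canonical (m%n<n _ N) e<N (begin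
      (α + σ * unapply e) % N           ≈⟨ %-≈ _ ⟩
      α + σ * unapply e                 ≈⟨ +-≈ʳ α (*-≈ʳ σ (%-≈ (τ * (e + neg α)))) ⟩
      α + σ * (τ * (e + neg α))         ≡⟨ regroup α σ τ (e + neg α) ⟩
      α + σ * τ * (e + neg α)           ≈⟨ +-≈ʳ α (*-≈ˡ (e + neg α) στ≈1) ⟩
      α + 1 * (e + neg α)               ≡⟨ unit α e (neg α) ⟩
      e + (α + neg α)                   ≈⟨ +-≈ʳ e (+-neg α) ⟩
      e + 0                             ≡⟨ +-identityʳ e ⟩
      e                                 ∎)
      where
      open import Relation.Binary.Reasoning.Setoid ≈-setoid
      regroup : ∀ a s t x → a + s * (t * x) ≡ a + s * t * x
      regroup = solve-∀
      unit : ∀ a e n → a + 1 * (e + n) ≡ e + (a + n)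
      unit = solve-∀

  [_] : ℕ → Fin N
  [ a ] = a mod N

  toℕ-[] : ∀ a → toℕ [ a ] ≡ a % N
  toℕ-[] a = Fin.toℕ-fromℕ< _

  []-≈ : ∀ a → toℕ [ a ] ≈ a
  []-≈ a = ≈-trans (≡⇒≈ (toℕ-[] a)) (%-≈ a)

  []-cong : ∀ {a b} → a ≈ b → [ a ] ≡ [ b ]
  []-cong {a} {b} (mod≡ p) = Fin.toℕ-injective (trans (toℕ-[] a) (trans p (sym (toℕ-[] b))))

  []-injective : ∀ {a b} → [ a ] ≡ [ b ] → a ≈ b
  []-injective {a} {b} p = mod≡ (trans (sym (toℕ-[] a)) (trans (cong toℕ p) (toℕ-[] b)))

  []-toℕ : ∀ (x : Fin N) → [ toℕ x ] ≡ x
  []-toℕ x = Fin.toℕ-injective (trans (toℕ-[] (toℕ x)) (m<n⇒m%n≡m (Fin.toℕ<n x)))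

data Relative (r r′ : Fin 3) : Set where
  same   : r ≡ r′ → Relative r r′
  ahead  : r′ ≡ next r → Relative r r′
  behind : r ≡ next r′ → Relative r r′

relative : ∀ r r′ → Relative r r′
relative 0F 0F = same refl
relative 0F 1F = ahead refl
relative 0F 2F = behind refl
relative 1F 0F = behind refl
relative 1F 1F = same refl
relative 1F 2F = ahead refl
relative 2F 0F = ahead refl
relative 2F 1F = behind refl
relative 2F 2F = same refl

next-irreflexive : ∀ (r : Fin 3) → next r ≢ r
next-irreflexive 0F ()
next-irreflexive 1F ()
next-irreflexive 2F ()

next-asymmetric : ∀ {r r′ : Fin 3} → r′ ≡ next r → r ≡ next r′ → ⊥
next-asymmetric {0F} refl ()
next-asymmetric {1F} refl ()
next-asymmetric {2F} refl ()

module Mod3 = Congruence 3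

hole : ℕ → Fin 3
hole = Mod3.[_]

hole-step : ∀ a l → hole (a + (1 + l * 3)) ≡ next (hole a)
hole-step a l = Mod3.[]-cong (begin
  a + (1 + l * 3)        ≡⟨ +-suc a (l * 3) ⟩
  suc a + l * 3          ≈⟨ Mod3.mod≡ ([m+kn]%n≡m%n (suc a) l 3) ⟩
  suc a                  ≈⟨ Mod3.+-≈ʳ 1 (Mod3.[]-≈ a) ⟨
  suc (toℕ (hole a))     ∎)
  where open import Relation.Binary.Reasoning.Setoid Mod3.≈-setoid

record Enumeration (A : Set) : Set where
  field
    elements : List A
    unique   : Unique elements
    complete : ∀ a → a ∈ elements

open Enumeration

finEnum : ∀ k → Enumeration (Fin k)
finEnum k = record { elements = allFin k ; unique = Unique.allFin⁺ k ; complete = ∈-allFin }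

_×-enum_ : ∀ {A B} → Enumeration A → Enumeration B → Enumeration (A × B)
EA ×-enum EB = record
  { elements = cartesianProduct (elements EA) (elements EB)
  ; unique   = Unique.cartesianProduct⁺ (unique EA) (unique EB)
  ; complete = λ (a , b) → ∈-cartesianProduct⁺ (complete EA a) (complete EB b) }

lookup-injective : ∀ {A : Set} {xs : List A} → Unique xs → ∀ i j → lookup xs i ≡ lookup xs j → i ≡ j
lookup-injective {xs = x ∷ xs} (x∉ ∷ u) zero    zero    e = refl
lookup-injective {xs = x ∷ xs} (x∉ ∷ u) zero    (suc j) e = ⊥-elim (All.lookup x∉ (∈-lookup j) e)
lookup-injective {xs = x ∷ xs} (x∉ ∷ u) (suc i) zero    e = ⊥-elim (All.lookup x∉ (∈-lookup i) (sym e))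
lookup-injective {xs = x ∷ xs} (x∉ ∷ u) (suc i) (suc j) e = cong suc (lookup-injective u i j e)

Σ-list : ∀ {A : Set} {B : A → Set} → List A → ((a : A) → List (B a)) → List (Σ A B)
Σ-list []       ys = []
Σ-list (a ∷ xs) ys = map (a ,_) (ys a) ++ Σ-list xs ys

Σ-list-first : ∀ {A : Set} {B : A → Set} xs (ys : (a : A) → List (B a)) {p} →
               p ∈ Σ-list xs ys → proj₁ p ∈ xs
Σ-list-first (a ∷ xs) ys p∈ with ∈-++⁻ (map (a ,_) (ys a)) p∈
... | inj₂ p∈rest = there (Σ-list-first xs ys p∈rest)
... | inj₁ p∈ys with ∈-map⁻ (a ,_) p∈ys
...   | _ , _ , refl = here refl

Σ-enum : ∀ {A : Set} {B : A → Set} → Enumeration A → ((a : A) → Enumeration (B a)) →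
         Enumeration (Σ A B)
Σ-enum {A} {B} EA EB = record
  { elements = Σ-list (elements EA) ys
  ; unique   = Σ-unique (unique EA)
  ; complete = λ (a , b) → Σ-complete (complete EA a) (complete (EB a) b) }
  where
  ys : (a : A) → List (B a)
  ys a = elements (EB a)

  pair-injective : ∀ {a} {b b′ : B a} → (a , b) ≡ (a , b′) → b ≡ b′
  pair-injective refl = refl

  Σ-unique : ∀ {xs} → Unique xs → Unique (Σ-list xs ys)
  Σ-unique {[]}     _           = []
  Σ-unique {a ∷ xs} (a∉ ∷ uxs) =
    Unique.++⁺ (Unique.map⁺ pair-injective (unique (EB a))) (Σ-unique uxs) disjoint
    where
    disjoint : ∀ {p} → p ∈ map (a ,_) (ys a) × p ∈ Σ-list xs ys → ⊥
    disjoint (p∈ys , p∈rest) with ∈-map⁻ (a ,_) p∈ys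
    ... | _ , _ , refl = All.lookup a∉ (Σ-list-first xs ys p∈rest) refl

  Σ-complete : ∀ {xs a} {b : B a} → a ∈ xs → b ∈ ys a → (a , b) ∈ Σ-list xs ys
  Σ-complete {a ∷ xs} (here refl) b∈ = ∈-++⁺ˡ (∈-map⁺ (a ,_) b∈)
  Σ-complete {x ∷ xs} (there a∈)  b∈ = ∈-++⁺ʳ (map (x ,_) (ys x)) (Σ-complete a∈ b∈)

-- Corner r of triangle b lies in group `group b r`; its arc r (from corner r to
-- corner r+1) carries a label in [0, m) and will have length 1 + 3·label in ℤ_{3m},
-- so consecutive corners always lie in consecutive holes.  The labels of a triangle
-- sum to −1 modulo m, which makes its three arc lengths sum to 0 in ℤ_{3m}.
-- Every triple (a, a′, e) of distinct groups and label e < m is carried by exactly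
-- one arc: `arcOf` finds it, and it is the only one.
record Starter (n m : ℕ) : Set₁ where
  field
    Base             : Set
    bases            : Enumeration Base
    group            : Base → Fin 3 → Fin n
    label            : Base → Fin 3 → ℕ
    corners-distinct : ∀ b r → group b r ≢ group b (next r)
    label<m          : ∀ b r → label b r < m
    labels-sum       : ∀ b → m ∣ label b 0F + label b 1F + label b 2F + 1
    arcOf            : Fin n → Fin n → ℕ → Base × Fin 3
    arcOf-sound      : ∀ a a′ e → a ≢ a′ → e < m →
                       let (b , r) = arcOf a a′ e in
                       group b r ≡ a × group b (next r) ≡ a′ × label b r ≡ e
    arcOf-arc        : ∀ b r → arcOf (group b r) (group b (next r)) (label b r) ≡ (b , r)

module Development {n m′ : ℕ} (S : Starter n (suc m′)) where
  open Starter S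

  m N : ℕ
  m = suc m′
  N = m * 3

  open Congruence N

  P : Set
  P = Point n N

  gap : Base → Fin 3 → ℕ
  gap b r = 1 + label b r * 3

  gap<N : ∀ b r → gap b r < N
  gap<N b r = ≤-trans (s≤s (s≤s (n≤1+n _))) (*-monoˡ-≤ 3 (label<m b r))

  gap/3 : ∀ b r → gap b r / 3 ≡ label b r
  gap/3 b r = trans (+-distrib-/-∣ʳ 1 {d = 3} (divides (label b r) refl)) (m*n/n≡m (label b r) 3)

  gaps-sum : ∀ b → gap b 0F + gap b 1F + gap b 2F ≈ 0
  gaps-sum b with labels-sum b
  ... | divides q eq = begin
    gap b 0F + gap b 1F + gap b 2F                      ≡⟨ rearrange (label b 0F) (label b 1F) (label b 2F) ⟩
    (label b 0F + label b 1F + label b 2F + 1) * 3     ≡⟨ cong (_* 3) eq ⟩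
    q * m * 3                                           ≡⟨ *-assoc q m 3 ⟩
    q * N                                               ≈⟨ multiple-≈0 q ⟩
    0                                                   ∎
    where
    open import Relation.Binary.Reasoning.Setoid ≈-setoid
    rearrange : ∀ x y z → 1 + x * 3 + (1 + y * 3) + (1 + z * 3) ≡ (x + y + z + 1) * 3
    rearrange = solve-∀

  offset : Base → Fin 3 → ℕ
  offset b 0F = 0
  offset b 1F = gap b 0F
  offset b 2F = gap b 0F + gap b 1F

  offset-next : ∀ b r → offset b (next r) ≈ offset b r + gap b r
  offset-next b 0F = ≡⇒≈ refl
  offset-next b 1F = ≡⇒≈ refl
  offset-next b 2F = ≈-sym (gaps-sum b)

  corner : Base → Fin N → Fin 3 → P
  corner b s r = group b r , [ toℕ s + offset b r ]

  block : Base × Fin N → Block n N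
  block (b , s) = corner b s 0F ∷ corner b s 1F ∷ corner b s 2F ∷ []

  holeOf : P → Fin 3
  holeOf (_ , x) = hole (toℕ x)

  sameHole⇒ : ∀ {p q} → SameHole 3 p q → holeOf p ≡ holeOf q
  sameHole⇒ {_ , x} {_ , y} h = Mod3.[]-cong (Mod3.mod≡ {toℕ x} {toℕ y} h)

  ⇒sameHole : ∀ {p q} → holeOf p ≡ holeOf q → SameHole 3 p q
  ⇒sameHole {_ , x} {_ , y} h = Mod3.mod-≡ (Mod3.[]-injective {toℕ x} {toℕ y} h)

  hole-[] : ∀ a → hole (toℕ [ a ]) ≡ hole a
  hole-[] a = Mod3.[]-cong (Mod3.mod≡ {toℕ [ a ]} {a} (≈-divisor 3 (divides m refl) ([]-≈ a)))

  corner-next : ∀ b s r → proj₂ (corner b s (next r)) ≡ [ toℕ (proj₂ (corner b s r)) + gap b r ]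
  corner-next b s r = []-cong (begin
    toℕ s + offset b (next r)            ≈⟨ +-≈ʳ (toℕ s) (offset-next b r) ⟩
    toℕ s + (offset b r + gap b r)       ≡⟨ +-assoc (toℕ s) (offset b r) (gap b r) ⟨
    toℕ s + offset b r + gap b r         ≈⟨ +-≈ˡ (gap b r) ([]-≈ (toℕ s + offset b r)) ⟨
    toℕ [ toℕ s + offset b r ] + gap b r ∎)
    where open import Relation.Binary.Reasoning.Setoid ≈-setoid

  corner-hole-next : ∀ b s r → holeOf (corner b s (next r)) ≡ next (holeOf (corner b s r))
  corner-hole-next b s r = begin
    hole (toℕ (proj₂ (corner b s (next r))))  ≡⟨ cong (hole ∘ toℕ) (corner-next b s r) ⟩
    hole (toℕ [ X + gap b r ])                 ≡⟨ hole-[] (X + gap b r) ⟩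
    hole (X + gap b r)                         ≡⟨ hole-step X (label b r) ⟩
    next (hole X)                              ∎
    where
    open ≡-Reasoning
    X = toℕ (proj₂ (corner b s r))

  diff : Fin N → Fin N → ℕ
  diff x y = (toℕ y + neg (toℕ x)) % N

  diff-≈ : ∀ x y → toℕ x + diff x y ≈ toℕ y
  diff-≈ x y = begin
    X + diff x y          ≈⟨ +-≈ʳ X (%-≈ (Y + neg X)) ⟩
    X + (Y + neg X)       ≡⟨ swap X Y (neg X) ⟩
    Y + (X + neg X)       ≈⟨ +-≈ʳ Y (+-neg X) ⟩
    Y + 0                 ≡⟨ +-identityʳ Y ⟩
    Y                     ∎
    where
    open import Relation.Binary.Reasoning.Setoid ≈-setoid
    X = toℕ x
    Y = toℕ y
    swap : ∀ a b c → a + (b + c) ≡ b + (a + c)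
    swap = solve-∀

  diff-unique : ∀ x y {d} → toℕ x + d ≈ toℕ y → d < N → diff x y ≡ d
  diff-unique x y {d} xd≈y d<N = ≈-canonical (m%n<n (toℕ y + neg (toℕ x)) N) d<N (+-cancelʳ-≈ (toℕ x) (begin
    diff x y + toℕ x    ≡⟨ +-comm (diff x y) (toℕ x) ⟩
    toℕ x + diff x y    ≈⟨ diff-≈ x y ⟩
    toℕ y               ≈⟨ xd≈y ⟨
    toℕ x + d           ≡⟨ +-comm (toℕ x) d ⟩
    d + toℕ x           ∎))
    where open import Relation.Binary.Reasoning.Setoid ≈-setoid

  translateAt : Fin N → Base × Fin 3 → Base × Fin N
  translateAt x (b , r) = b , [ toℕ x + neg (offset b r) ]

  translateAt-corner : ∀ x b r → proj₂ (corner b (proj₂ (translateAt x (b , r))) r) ≡ x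
  translateAt-corner x b r = trans ([]-cong (≈-trans
    (+-≈ˡ (offset b r) ([]-≈ (toℕ x + neg (offset b r))))
    (+-neg-inverseˡ (toℕ x) (offset b r)))) ([]-toℕ x)

  translateAt-translate : ∀ b s r → translateAt (proj₂ (corner b s r)) (b , r) ≡ (b , s)
  translateAt-translate b s r = cong (b ,_) (trans ([]-cong (≈-trans
    (+-≈ˡ (neg (offset b r)) ([]-≈ (toℕ s + offset b r)))
    (+-neg-inverseʳ (toℕ s) (offset b r)))) ([]-toℕ s))

  -- The translate containing an arc from p to q: the arc is identified by the groups
  -- of p and q and by the label read off the difference of their coordinates.
  through : P → P → Base × Fin N
  through (a , x) (a′ , y) = translateAt x (arcOf a a′ (diff x y / 3))

  diff-corners : ∀ b s r → diff (proj₂ (corner b s r)) (proj₂ (corner b s (next r))) ≡ gap b r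
  diff-corners b s r = diff-unique _ _ (begin
    toℕ (proj₂ (corner b s r)) + gap b r                ≈⟨ []-≈ _ ⟨
    toℕ [ toℕ (proj₂ (corner b s r)) + gap b r ]        ≡⟨ cong toℕ (corner-next b s r) ⟨
    toℕ (proj₂ (corner b s (next r)))                   ∎) (gap<N b r)
    where open import Relation.Binary.Reasoning.Setoid ≈-setoid

  through-arc : ∀ b s r → through (corner b s r) (corner b s (next r)) ≡ (b , s)
  through-arc b s r = begin
    translateAt x (arcOf (group b r) (group b (next r)) (diff x y / 3))
      ≡⟨ cong (λ e → translateAt x (arcOf (group b r) (group b (next r)) e))
              (trans (cong (_/ 3) (diff-corners b s r)) (gap/3 b r)) ⟩
    translateAt x (arcOf (group b r) (group b (next r)) (label b r))
      ≡⟨ cong (translateAt x) (arcOf-arc b r) ⟩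
    translateAt x (b , r)
      ≡⟨ translateAt-translate b s r ⟩
    (b , s) ∎
    where
    open ≡-Reasoning
    x = proj₂ (corner b s r)
    y = proj₂ (corner b s (next r))

  diff-shape : ∀ x y → hole (toℕ y) ≡ next (hole (toℕ x)) →
               diff x y ≡ 1 + diff x y / 3 * 3 × diff x y / 3 < m
  diff-shape x y h = shape , *-cancelʳ-< 3 _ m (≤-trans (n≤1+n _) (subst (_< N) shape (m%n<n (toℕ y + neg (toℕ x)) N)))
    where
    d = diff x y
    d≈1 : d Mod3.≈ 1
    d≈1 = Mod3.+-cancelʳ-≈ (toℕ x) (begin
      d + toℕ x         ≡⟨ +-comm d (toℕ x) ⟩
      toℕ x + d         ≈⟨ Mod3.mod≡ (≈-divisor 3 (divides m refl) (diff-≈ x y)) ⟩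
      toℕ y             ≈⟨ Mod3.[]-injective h ⟩
      suc (toℕ (hole (toℕ x)))  ≈⟨ Mod3.+-≈ʳ 1 (Mod3.[]-≈ (toℕ x)) ⟩
      1 + toℕ x         ∎)
      where open import Relation.Binary.Reasoning.Setoid Mod3.≈-setoid
    shape : d ≡ 1 + d / 3 * 3
    shape = trans (m≡m%n+[m/n]*n d 3) (cong (_+ d / 3 * 3) (Mod3.mod-≡ d≈1))

  through-sound : ∀ p q → proj₁ p ≢ proj₁ q → holeOf q ≡ next (holeOf p) →
                  ∃[ r ] corner (proj₁ (through p q)) (proj₂ (through p q)) r ≡ p
                       × corner (proj₁ (through p q)) (proj₂ (through p q)) (next r) ≡ q
  through-sound (a , x) (a′ , y) a≢a′ h
    with diff-shape x y h
  ... | d≡ , e<m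
    with arcOf a a′ (diff x y / 3) | arcOf-sound a a′ (diff x y / 3) a≢a′ e<m
  ... | b , r | ga , ga′ , le = r , cong₂ _,_ ga (translateAt-corner x b r) , cong₂ _,_ ga′ second
    where
    s = proj₂ (translateAt x (b , r))
    second : proj₂ (corner b s (next r)) ≡ y
    second = trans (corner-next b s r) (trans ([]-cong (begin
      toℕ (proj₂ (corner b s r)) + gap b r     ≡⟨ cong₂ (λ u l → toℕ u + (1 + l * 3)) (translateAt-corner x b r) le ⟩
      toℕ x + (1 + diff x y / 3 * 3)           ≡⟨ cong (toℕ x +_) d≡ ⟨
      toℕ x + diff x y                         ≈⟨ diff-≈ x y ⟩
      toℕ y                                    ∎)) ([]-toℕ y))
      where open import Relation.Binary.Reasoning.Setoid ≈-setoid

  corners-differ : ∀ b {r r′} → r ≢ r′ → group b r ≢ group b r′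
  corners-differ b {r} {r′} r≢r′ with relative r r′
  ... | same r≡r′   = ⊥-elim (r≢r′ r≡r′)
  ... | ahead refl  = corners-distinct b r
  ... | behind refl = corners-distinct b r′ ∘ sym

  corner-holes-differ : ∀ b s {r r′} → r ≢ r′ → holeOf (corner b s r) ≢ holeOf (corner b s r′)
  corner-holes-differ b s {r} {r′} r≢r′ with relative r r′
  ... | same r≡r′   = ⊥-elim (r≢r′ r≡r′)
  ... | ahead refl  = λ e → next-irreflexive _ (trans (sym (corner-hole-next b s r)) (sym e))
  ... | behind refl = λ e → next-irreflexive _ (trans (sym (corner-hole-next b s r′)) e)

  corner∈block : ∀ b s r → corner b s r ∈ block (b , s)
  corner∈block b s 0F = here refl
  corner∈block b s 1F = there (here refl)
  corner∈block b s 2F = there (there (here refl))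

  block-corner : ∀ b s {p} → p ∈ block (b , s) → ∃[ r ] p ≡ corner b s r
  block-corner b s (here p≡)                 = 0F , p≡
  block-corner b s (there (here p≡))         = 1F , p≡
  block-corner b s (there (there (here p≡))) = 2F , p≡

  distinct-corners : ∀ b s {p q} → p ∈ block (b , s) → q ∈ block (b , s) → p ≢ q →
                     ∃[ r ] ∃[ r′ ] r ≢ r′ × p ≡ corner b s r × q ≡ corner b s r′
  distinct-corners b s p∈ q∈ p≢q with block-corner b s p∈ | block-corner b s q∈
  ... | r , refl | r′ , refl = r , r′ , (λ { refl → p≢q refl }) , refl , refl

  block-unique : ∀ c → Unique (block c)
  block-unique (b , s) = (differ 0F 1F (λ ()) ∷ differ 0F 2F (λ ()) ∷ []) ∷ (differ 1F 2F (λ ()) ∷ []) ∷ [] ∷ []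
    where
    differ : ∀ r r′ → r ≢ r′ → corner b s r ≢ corner b s r′
    differ r r′ r≢r′ = corners-differ b r≢r′ ∘ cong proj₁

  no-group-pair : ∀ c {p q} → p ∈ block c → q ∈ block c → p ≢ q → ¬ SameGroup p q
  no-group-pair (b , s) p∈ q∈ p≢q with distinct-corners b s p∈ q∈ p≢q
  ... | r , r′ , r≢r′ , refl , refl = corners-differ b r≢r′

  no-hole-pair : ∀ c {p q} → p ∈ block c → q ∈ block c → p ≢ q → ¬ SameHole 3 p q
  no-hole-pair (b , s) p∈ q∈ p≢q with distinct-corners b s p∈ q∈ p≢q
  ... | r , r′ , r≢r′ , refl , refl = corner-holes-differ b s r≢r′ ∘ sameHole⇒ {corner b s r} {corner b s r′}

  -- A block determines its translate: two consecutive corners already do.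
  block-injective : ∀ {c c′} → block c ≡ block c′ → c ≡ c′
  block-injective {b , s} {b′ , s′} e = begin
    (b , s)                                         ≡⟨ through-arc b s 0F ⟨
    through (corner b s 0F) (corner b s 1F)         ≡⟨ cong₂ through (∷-injectiveˡ e) (∷-injectiveˡ (∷-injectiveʳ e)) ⟩
    through (corner b′ s′ 0F) (corner b′ s′ 1F)     ≡⟨ through-arc b′ s′ 0F ⟩
    (b′ , s′)                                       ∎
    where open ≡-Reasoning

  translates : Enumeration (Base × Fin N)
  translates = bases ×-enum finEnum N

  blocks : List (Block n N)
  blocks = map block (elements translates)

  blocks-unique : Unique blocks
  blocks-unique = Unique.map⁺ block-injective (unique translates)

  all-blocks : ∀ {Q : Block n N → Set} → (∀ c → Q (block c)) → All Q blocks
  all-blocks f = All.map⁺ (All.tabulate (λ {c} _ → f c))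

  Covered : P → P → Set
  Covered p q = ∃! _≡_ (λ (k : Fin (length blocks)) → p ∈ lookup blocks k × q ∈ lookup blocks k)

  covered-sym : ∀ {p q} → Covered p q → Covered q p
  covered-sym (k , (p∈ , q∈) , unique-k) = k , (q∈ , p∈) , λ (q∈′ , p∈′) → unique-k (p∈′ , q∈′)

  -- If q lies one hole after p, the translate `through p q` covers {p, q}, and any
  -- block containing p and q is that translate: in it, q cannot sit at the corner
  -- before p, since that would put q one hole before p.
  cover-forward : ∀ p q → proj₁ p ≢ proj₁ q → holeOf q ≡ next (holeOf p) → Covered p q
  cover-forward p q p≁q h with through-sound p q p≁q h
  ... | r , cp , cq = k , (subst (_∈ lookup blocks k) cp (at-k r) , subst (_∈ lookup blocks k) cq (at-k (next r))) , only-k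
    where
    c = through p q
    c∈ : block c ∈ blocks
    c∈ = ∈-map⁺ block (complete translates c)
    k = index c∈
    at-k : ∀ r → corner (proj₁ c) (proj₂ c) r ∈ lookup blocks k
    at-k r = subst (corner (proj₁ c) (proj₂ c) r ∈_) (lookup-index c∈) (corner∈block (proj₁ c) (proj₂ c) r)
    only-k : ∀ {k′} → p ∈ lookup blocks k′ × q ∈ lookup blocks k′ → k ≡ k′
    only-k {k′} (p∈ , q∈) with ∈-map⁻ block (∈-lookup {xs = blocks} k′)
    ... | (b′ , s′) , _ , k′≡ with block-corner b′ s′ (subst (p ∈_) k′≡ p∈) | block-corner b′ s′ (subst (q ∈_) k′≡ q∈)
    ... | r₁ , p≡ | r₂ , q≡ with relative r₁ r₂
    ...   | same e   = ⊥-elim (p≁q (trans (cong proj₁ p≡) (trans (cong (group b′) e) (sym (cong proj₁ q≡)))))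
    ...   | ahead e  = lookup-injective blocks-unique k k′
                         (trans (sym (lookup-index c∈)) (trans (cong block c≡) (sym k′≡)))
      where
      c≡ : c ≡ (b′ , s′)
      c≡ = trans (cong₂ through p≡ (trans q≡ (cong (corner b′ s′) e))) (through-arc b′ s′ r₁)
    ...   | behind e = ⊥-elim (next-asymmetric h (begin
      holeOf p                           ≡⟨ cong holeOf p≡ ⟩
      holeOf (corner b′ s′ r₁)           ≡⟨ cong (holeOf ∘ corner b′ s′) e ⟩
      holeOf (corner b′ s′ (next r₂))    ≡⟨ corner-hole-next b′ s′ r₂ ⟩
      next (holeOf (corner b′ s′ r₂))    ≡⟨ cong (next ∘ holeOf) q≡ ⟨
      next (holeOf q)                    ∎))
      where open ≡-Reasoning

  -- Points in different groups and holes: one is one hole after the other.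
  cover : ∀ p q → p ≢ q → ¬ SameGroup p q → ¬ SameHole 3 p q → Covered p q
  cover p q _ p≁q p≉q with relative (holeOf p) (holeOf q)
  ... | same e   = ⊥-elim (p≉q (⇒sameHole {p} {q} e))
  ... | ahead e  = cover-forward p q p≁q e
  ... | behind e = covered-sym (cover-forward q p (p≁q ∘ sym) e)

  shift-corner : ∀ b s r → shift (corner b s r) ≡ corner b [ toℕ s + 1 ] r
  shift-corner b s r = cong (group b r ,_) ([]-cong (begin
    suc (toℕ [ toℕ s + offset b r ])      ≈⟨ +-≈ʳ 1 ([]-≈ (toℕ s + offset b r)) ⟩
    suc (toℕ s + offset b r)              ≡⟨ cong (_+ offset b r) (+-comm 1 (toℕ s)) ⟩
    toℕ s + 1 + offset b r                ≈⟨ +-≈ˡ (offset b r) ([]-≈ (toℕ s + 1)) ⟨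
    toℕ [ toℕ s + 1 ] + offset b r        ∎))
    where open import Relation.Binary.Reasoning.Setoid ≈-setoid

  shift-block : ∀ c → ∃ (λ bl → bl ∈ blocks × map shift (block c) ↭ bl)
  shift-block (b , s) = block (b , s′) , ∈-map⁺ block (complete translates (b , s′)) ,
    ↭-reflexive (cong₂ _∷_ (shift-corner b s 0F) (cong₂ _∷_ (shift-corner b s 1F) (cong₂ _∷_ (shift-corner b s 2F) refl)))
    where s′ = [ toℕ s + 1 ]

  development : Exists3SCHGDD n m 3
  development = record
    { blocks   = blocks
    ; isSCHGDD = record
      { hgdd = record
        { blockSize     = all-blocks (λ _ → refl)
        ; blockDistinct = all-blocks block-unique
        ; noGroupPair   = all-blocks no-group-pair
        ; noHolePair    = all-blocks no-hole-pair
        ; cover         = cover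
        }
      ; invariant = all-blocks shift-block
      }
    }

module Tiling {S : Set} (len start : S → ℕ) where

  -- `Tiles a b ss`: laid end to end from position a, the segments ss sit exactly at
  -- their starts and end at position b; so they partition [a, b).
  data Tiles (a b : ℕ) : List S → Set where
    done : a ≡ b → Tiles a b []
    _∷_  : ∀ {s ss} → start s ≡ a → Tiles (a + len s) b ss → Tiles a b (s ∷ ss)

  locate : ∀ {a b ss} → Tiles a b ss → (c : ℕ) → .(a ≤ c) → .(c < b) → Σ S (Fin ∘ len)
  locate (done refl) c a≤c c<b = Irrelevant.⊥-elim (<⇒≱ c<b a≤c)
  locate {a} (_∷_ {s} _ t) c a≤c c<b with c <? a + len s
  ... | yes c<end = s , fromℕ< (subst (c ∸ a <_) (m+n∸m≡n a (len s)) (∸-monoˡ-< c<end a≤c))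
  ... | no  c≮end = locate t c (≮⇒≥ c≮end) c<b

  locate-sound : ∀ {a b ss} (t : Tiles a b ss) c (a≤c : a ≤ c) .(c<b : c < b) →
                 let (s , x) = locate t c a≤c c<b in s ∈ ss × c ≡ start s + toℕ x
  locate-sound (done refl) c a≤c c<b = Irrelevant.⊥-elim (<⇒≱ c<b a≤c)
  locate-sound {a} (_∷_ {s} s≡a t) c a≤c c<b with c <? a + len s
  ... | yes c<end = here refl , (begin
    c                                 ≡⟨ m+[n∸m]≡n a≤c ⟨
    a + (c ∸ a)                       ≡⟨ cong₂ _+_ (sym s≡a) (sym (Fin.toℕ-fromℕ< _)) ⟩
    start s + toℕ (fromℕ< _)          ∎)
    where open ≡-Reasoning
  ... | no  c≮end with locate-sound t c (≮⇒≥ c≮end) c<b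
  ...   | s∈ , c≡ = there s∈ , c≡

  tiles-≤ : ∀ {a b ss} → Tiles a b ss → a ≤ b
  tiles-≤ (done a≡b) = ≤-reflexive a≡b
  tiles-≤ {a} (_∷_ {s} _ t) = ≤-trans (m≤m+n a (len s)) (tiles-≤ t)

  tile-bounds : ∀ {a b ss s} → Tiles a b ss → s ∈ ss → a ≤ start s × start s + len s ≤ b
  tile-bounds {a} (_∷_ {s} s≡a t) (here refl) =
    ≤-reflexive (sym s≡a) , subst (λ z → z + len s ≤ _) (sym s≡a) (tiles-≤ t)
  tile-bounds {a} (_∷_ {s′} _ t) (there s∈) with tile-bounds t s∈
  ... | lower , upper = ≤-trans (m≤m+n a (len s′)) lower , upper

  locate-start : ∀ {a b ss s} (t : Tiles a b ss) → s ∈ ss → (x : Fin (len s)) →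
                 ∀ .{l u} → locate t (start s + toℕ x) l u ≡ (s , x)
  locate-start {a} (_∷_ {s} s≡a t) (here refl) x with start s + toℕ x <? a + len s
  ... | yes _ = cong (s ,_) (Fin.toℕ-injective (trans (Fin.toℕ-fromℕ< _) (begin
    start s + toℕ x ∸ a     ≡⟨ cong (λ z → z + toℕ x ∸ a) s≡a ⟩
    a + toℕ x ∸ a           ≡⟨ m+n∸m≡n a (toℕ x) ⟩
    toℕ x                   ∎)))
    where open ≡-Reasoning
  ... | no c≮end = ⊥-elim (c≮end (subst (λ z → start s + toℕ x < z + len s) s≡a (+-monoʳ-< (start s) (Fin.toℕ<n x))))
  locate-start {a} {s = s} (_∷_ {s′} _ t) (there s∈) x with start s + toℕ x <? a + len s′
  ... | yes c<end = ⊥-elim (<⇒≱ c<end (≤-trans (proj₁ (tile-bounds t s∈)) (m≤m+n (start s) (toℕ x))))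
  ... | no  _     = locate-start t s∈ x

  locate-at : ∀ {a b ss s} (t : Tiles a b ss) → s ∈ ss → (x : Fin (len s)) →
              ∀ {c} → c ≡ start s + toℕ x → ∀ .{l u} → locate t c l u ≡ (s , x)
  locate-at t s∈ x refl {l} {u} = locate-start t s∈ x {l} {u}

all-enum? : ∀ {A : Set} {P : A → Set} → Enumeration A → (∀ a → Dec (P a)) → Dec (∀ a → P a)
all-enum? E P? = map′ (λ all a → All.lookup all (Enumeration.complete E a))
                      (λ every → All.tabulate (λ {a} _ → every a))
                      (All.all? P? (Enumeration.elements E))

module Mod5 = Congruence 5

_⊕_ : Fin 5 → ℕ → Fin 5
v ⊕ d = Mod5.[ toℕ v + d ]

_⊖_ : Fin 5 → ℕ → Fin 5
v ⊖ d = v ⊕ Mod5.neg d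

⊕-⊖ : ∀ v d → (v ⊕ d) ⊖ d ≡ v
⊕-⊖ v d = trans (Mod5.[]-cong (Mod5.≈-trans
  (Mod5.+-≈ˡ (Mod5.neg d) (Mod5.[]-≈ (toℕ v + d)))
  (Mod5.+-neg-inverseʳ (toℕ v) d))) (Mod5.[]-toℕ v)

-- The six groups: ∞ (index 0) and the elements of ℤ_5 (index 1 + v).  A vertex of a
-- base triangle is ∞ or an element of ℤ_5, and is placed by a rotation i ∈ ℤ_5.
data Vertex : Set where
  ∞   : Vertex
  ⟨_⟩ : ℕ → Vertex

rotate : Fin 5 → Vertex → Fin 6
rotate i ∞     = zero
rotate i ⟨ d ⟩ = suc (i ⊕ d)

-- The rotation orbits of ordered pairs of distinct groups: v → v + d (d = 1..4),
-- ∞ → v, and v → ∞.  Each has a representative arc anchored at 0.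
data Kind : Set where
  δ1 δ2 δ3 δ4 from∞ to∞ : Kind

representative : Kind → Vertex × Vertex
representative δ1    = ⟨ 0 ⟩ , ⟨ 1 ⟩
representative δ2    = ⟨ 0 ⟩ , ⟨ 2 ⟩
representative δ3    = ⟨ 0 ⟩ , ⟨ 3 ⟩
representative δ4    = ⟨ 0 ⟩ , ⟨ 4 ⟩
representative from∞ = ∞ , ⟨ 0 ⟩
representative to∞   = ⟨ 0 ⟩ , ∞

arcEnds : Kind × Fin 5 → Fin 6 × Fin 6
arcEnds (o , v) = rotate v (proj₁ (representative o)) , rotate v (proj₂ (representative o))

classify : Fin 6 → Fin 6 → Maybe (Kind × Fin 5)
classify zero    zero    = nothing
classify zero    (suc v) = just (from∞ , v)
classify (suc u) zero    = just (to∞ , u)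
classify (suc u) (suc v) = Maybe.map (_, u) (stepKind (toℕ (v ⊖ toℕ u)))
  where
  stepKind : ℕ → Maybe Kind
  stepKind 1 = just δ1
  stepKind 2 = just δ2
  stepKind 3 = just δ3
  stepKind 4 = just δ4
  stepKind _ = nothing

kindCode : Kind → Fin 6
kindCode δ1    = 0F
kindCode δ2    = 1F
kindCode δ3    = 2F
kindCode δ4    = suc 2F
kindCode from∞ = suc (suc 2F)
kindCode to∞   = suc (suc (suc 2F))

kindCode-injective : ∀ {o o′} → kindCode o ≡ kindCode o′ → o ≡ o′
kindCode-injective {o} {o′} e = trans (sym (decode-code o)) (trans (cong decode e) (decode-code o′))
  where
  decode : Fin 6 → Kind
  decode 0F                        = δ1
  decode 1F                        = δ2
  decode 2F                        = δ3
  decode (suc 2F)                  = δ4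
  decode (suc (suc 2F))            = from∞
  decode (suc (suc (suc 2F)))      = to∞
  decode-code : ∀ o → decode (kindCode o) ≡ o
  decode-code δ1    = refl
  decode-code δ2    = refl
  decode-code δ3    = refl
  decode-code δ4    = refl
  decode-code from∞ = refl
  decode-code to∞   = refl

_≟ₖ_ : (o o′ : Kind) → Dec (o ≡ o′)
o ≟ₖ o′ = map′ kindCode-injective (cong kindCode) (kindCode o Fin.≟ kindCode o′)

data Family : Set where
  T113 T221 T442 T∞2 T∞3 T∞4 : Family

shape : Family → Vec Vertex 3
shape T113 = ⟨ 0 ⟩ ∷ ⟨ 1 ⟩ ∷ ⟨ 2 ⟩ ∷ []
shape T221 = ⟨ 0 ⟩ ∷ ⟨ 2 ⟩ ∷ ⟨ 4 ⟩ ∷ []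
shape T442 = ⟨ 0 ⟩ ∷ ⟨ 4 ⟩ ∷ ⟨ 3 ⟩ ∷ []
shape T∞2  = ∞ ∷ ⟨ 0 ⟩ ∷ ⟨ 2 ⟩ ∷ []
shape T∞3  = ∞ ∷ ⟨ 0 ⟩ ∷ ⟨ 3 ⟩ ∷ []
shape T∞4  = ∞ ∷ ⟨ 0 ⟩ ∷ ⟨ 4 ⟩ ∷ []

kinds : Family → Vec Kind 3
kinds T113 = δ1 ∷ δ1 ∷ δ3 ∷ []
kinds T221 = δ2 ∷ δ2 ∷ δ1 ∷ []
kinds T442 = δ4 ∷ δ4 ∷ δ2 ∷ []
kinds T∞2  = from∞ ∷ δ2 ∷ to∞ ∷ []
kinds T∞3  = from∞ ∷ δ3 ∷ to∞ ∷ []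
kinds T∞4  = from∞ ∷ δ4 ∷ to∞ ∷ []

vertex : Family → Fin 3 → Vertex
vertex f r = at (shape f) r

kind : Family → Fin 3 → Kind
kind f r = at (kinds f) r

anchor : Family → Fin 3 → ℕ
anchor f r = anchorOf (vertex f r) (vertex f (next r))
  where
  anchorOf : Vertex → Vertex → ℕ
  anchorOf ⟨ d ⟩ _     = d
  anchorOf ∞     ⟨ d ⟩ = d
  anchorOf ∞     ∞     = 0

families : Enumeration Family
families = record
  { elements = T113 ∷ T221 ∷ T442 ∷ T∞2 ∷ T∞3 ∷ T∞4 ∷ []
  ; unique   = ((λ ()) ∷ (λ ()) ∷ (λ ()) ∷ (λ ()) ∷ (λ ()) ∷ []) ∷ ((λ ()) ∷ (λ ()) ∷ (λ ()) ∷ (λ ()) ∷ []) ∷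
               ((λ ()) ∷ (λ ()) ∷ (λ ()) ∷ []) ∷ ((λ ()) ∷ (λ ()) ∷ []) ∷ ((λ ()) ∷ []) ∷ [] ∷ []
  ; complete = λ { T113 → here refl ; T221 → there (here refl) ; T442 → there (there (here refl))
                 ; T∞2 → there (there (there (here refl))) ; T∞3 → there (there (there (there (here refl))))
                 ; T∞4 → there (there (there (there (there (here refl))))) } }

∀-rotation-family-corner? : {P : Fin 5 → Family → Fin 3 → Set} → (∀ i f r → Dec (P i f r)) →
                            Dec (∀ i f r → P i f r)
∀-rotation-family-corner? P? = Fin.all? λ i → all-enum? families λ f → Fin.all? λ r → P? i f r

pair-≟ : (p q : Fin 6 × Fin 6) → Dec (p ≡ q)
pair-≟ = Product.≡-dec Fin._≟_ Fin._≟_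

arc-groups-differ : ∀ i f r → rotate i (vertex f r) ≢ rotate i (vertex f (next r))
arc-groups-differ = from-yes (∀-rotation-family-corner? λ i f r →
  ¬? (rotate i (vertex f r) Fin.≟ rotate i (vertex f (next r))))

classify-arc : ∀ i f r → classify (rotate i (vertex f r)) (rotate i (vertex f (next r)))
                         ≡ just (kind f r , i ⊕ anchor f r)
classify-arc = from-yes (∀-rotation-family-corner? λ i f r →
  Maybe.≡-dec (Product.≡-dec _≟ₖ_ Fin._≟_)
    (classify (rotate i (vertex f r)) (rotate i (vertex f (next r)))) (just (kind f r , i ⊕ anchor f r)))

arc-at-anchor : ∀ v f r → (rotate (v ⊖ anchor f r) (vertex f r) , rotate (v ⊖ anchor f r) (vertex f (next r)))
                          ≡ arcEnds (kind f r , v)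
arc-at-anchor = from-yes (∀-rotation-family-corner? λ v f r →
  pair-≟ (rotate (v ⊖ anchor f r) (vertex f r) , rotate (v ⊖ anchor f r) (vertex f (next r)))
         (arcEnds (kind f r , v)))

classify-sound : ∀ a a′ → a ≡ a′ ⊎ Maybe.map arcEnds (classify a a′) ≡ just (a , a′)
classify-sound = from-yes (Fin.all? λ a → Fin.all? λ a′ →
  (a Fin.≟ a′) ⊎-dec Maybe.≡-dec pair-≟ (Maybe.map arcEnds (classify a a′)) (just (a , a′)))

-- Ring identities behind the construction, for m = 2j + 3: σ·τ ≡ 1 for the kinds
-- δ2, δ3; the ends of the tilings; and, family by family, the unreduced labels of a
-- triangle plus 1 form a multiple of m (stated exactly as `raw` below unfolds).
σ-inverse : ∀ j → (1 + 2 * j) * (1 + j) ≡ 1 + j * suc (suc j + suc j)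
σ-inverse = solve-∀

end-δ2 : ∀ j → suc j + j + 1 + 1 ≡ suc (suc j + suc j)
end-δ2 = solve-∀

end-∞ : ∀ j → suc (suc j) + j + 1 ≡ suc (suc j + suc j)
end-∞ = solve-∀

sum-T113 : ∀ j x → (1 + 1 * x) + (1 + 1 * (suc j + x)) + ((2 + 3 * j) + (1 + 2 * j) * x) + 1
                   ≡ (x + 2) * suc (suc j + suc j)
sum-T113 = solve-∀

sum-T221 : ∀ j → ((1 + 3 * j) + (1 + 2 * j) * (suc j + j + 0)) + ((1 + 3 * j) + (1 + 2 * j) * (suc j + j + 1 + 0))
                 + (1 + 1 * (suc j + suc j + 0)) + 1 ≡ (3 + 4 * j) * suc (suc j + suc j)
sum-T221 = solve-∀

sum-T442 : ∀ j x → ((3 + j) + 1 * x) + ((3 + j) + 1 * (suc j + x)) + ((1 + 3 * j) + (1 + 2 * j) * x) + 1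
                   ≡ (x + 3) * suc (suc j + suc j)
sum-T442 = solve-∀

sum-T∞2 : ∀ j x → (0 + 1 * (suc (suc j) + x)) + ((1 + 3 * j) + (1 + 2 * j) * (suc j + x)) + ((2 + j) + 1 * (suc (suc j) + x)) + 1
                  ≡ (x + j + 3) * suc (suc j + suc j)
sum-T∞2 = solve-∀

sum-T∞3 : ∀ j x → (0 + 1 * x) + ((2 + 3 * j) + (1 + 2 * j) * (suc j + x)) + ((2 + j) + 1 * x) + 1
                  ≡ (x + j + 2) * suc (suc j + suc j)
sum-T∞3 = solve-∀

sum-T∞4 : ∀ j → (0 + 1 * (suc (suc j) + j + 0)) + ((3 + j) + 1 * (suc j + suc j + 0)) + ((2 + j) + 1 * (suc (suc j) + j + 0)) + 1
                ≡ 4 * suc (suc j + suc j)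
sum-T∞4 = solve-∀

module Construction (j : ℕ) where

  k m : ℕ
  k = suc j
  m = suc (k + k)

  size : Family → ℕ
  size T113 = k
  size T221 = 1
  size T442 = k
  size T∞2  = j
  size T∞3  = suc k
  size T∞4  = 1

  -- Arc r of the x-th triangle of family f occupies position starts f r + x among the
  -- arcs of its kind.
  starts : Family → Vec ℕ 3
  starts T113 = 0 ∷ k ∷ 0 ∷ []
  starts T221 = k + j ∷ k + j + 1 ∷ k + k ∷ []
  starts T442 = 0 ∷ k ∷ 0 ∷ []
  starts T∞2  = suc k ∷ k ∷ suc k ∷ []
  starts T∞3  = 0 ∷ k ∷ 0 ∷ []
  starts T∞4  = suc k + j ∷ k + k ∷ suc k + j ∷ []

  ArcType : Set
  ArcType = Family × Fin 3

  arcSize arcStart : ArcType → ℕ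
  arcSize (f , _)  = size f
  arcStart (f , r) = at (starts f) r

  open Tiling arcSize arcStart

  tiles : Kind → List ArcType
  tiles δ1    = (T113 , 0F) ∷ (T113 , 1F) ∷ (T221 , 2F) ∷ []
  tiles δ2    = (T442 , 2F) ∷ (T∞2 , 1F) ∷ (T221 , 0F) ∷ (T221 , 1F) ∷ []
  tiles δ3    = (T113 , 2F) ∷ (T∞3 , 1F) ∷ []
  tiles δ4    = (T442 , 0F) ∷ (T442 , 1F) ∷ (T∞4 , 1F) ∷ []
  tiles from∞ = (T∞3 , 0F) ∷ (T∞2 , 0F) ∷ (T∞4 , 0F) ∷ []
  tiles to∞   = (T∞3 , 2F) ∷ (T∞2 , 2F) ∷ (T∞4 , 2F) ∷ []

  tiling : ∀ o → Tiles 0 m (tiles o)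
  tiling δ1    = refl ∷ refl ∷ refl ∷ done (+-comm (k + k) 1)
  tiling δ2    = refl ∷ refl ∷ refl ∷ refl ∷ done (end-δ2 j)
  tiling δ3    = refl ∷ refl ∷ done (+-suc k k)
  tiling δ4    = refl ∷ refl ∷ refl ∷ done (+-comm (k + k) 1)
  tiling from∞ = refl ∷ refl ∷ refl ∷ done (end-∞ j)
  tiling to∞   = refl ∷ refl ∷ refl ∷ done (end-∞ j)

  tiles-kind : ∀ o → All (λ (f , r) → kind f r ≡ o) (tiles o)
  tiles-kind δ1    = refl ∷ refl ∷ refl ∷ []
  tiles-kind δ2    = refl ∷ refl ∷ refl ∷ refl ∷ []
  tiles-kind δ3    = refl ∷ refl ∷ []
  tiles-kind δ4    = refl ∷ refl ∷ refl ∷ []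
  tiles-kind from∞ = refl ∷ refl ∷ refl ∷ []
  tiles-kind to∞   = refl ∷ refl ∷ refl ∷ []

  tile∈ : ∀ f r → (f , r) ∈ tiles (kind f r)
  tile∈ T113 0F = here refl
  tile∈ T113 1F = there (here refl)
  tile∈ T113 2F = here refl
  tile∈ T221 0F = there (there (here refl))
  tile∈ T221 1F = there (there (there (here refl)))
  tile∈ T221 2F = there (there (here refl))
  tile∈ T442 0F = here refl
  tile∈ T442 1F = there (here refl)
  tile∈ T442 2F = here refl
  tile∈ T∞2  0F = there (here refl)
  tile∈ T∞2  1F = there (here refl)
  tile∈ T∞2  2F = there (here refl)
  tile∈ T∞3  0F = here refl
  tile∈ T∞3  1F = there (here refl)
  tile∈ T∞3  2F = here refl
  tile∈ T∞4  0F = there (there (here refl))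
  tile∈ T∞4  1F = there (there (here refl))
  tile∈ T∞4  2F = there (there (here refl))

  module Mod-m = Congruence m

  -- Position c among the arcs of kind o is labelled α o + σ o · c (mod m); for each
  -- kind this is a permutation of ℤ_m, since σ o is invertible with inverse τ o.
  α σ τ : Kind → ℕ
  α δ1    = 1
  α δ2    = 1 + 3 * j
  α δ3    = 2 + 3 * j
  α δ4    = 3 + j
  α from∞ = 0
  α to∞   = 2 + j
  σ δ2 = 1 + 2 * j
  σ δ3 = 1 + 2 * j
  σ _  = 1
  τ δ2 = 1 + j
  τ δ3 = 1 + j
  τ _  = 1

  στ≈1 : ∀ o → σ o * τ o Mod-m.≈ 1
  στ≈1 δ1    = Mod-m.≡⇒≈ refl
  στ≈1 δ2    = Mod-m.≈-trans (Mod-m.≡⇒≈ (σ-inverse j)) (Mod-m.+-≈ʳ 1 (Mod-m.multiple-≈0 j))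
  στ≈1 δ3    = Mod-m.≈-trans (Mod-m.≡⇒≈ (σ-inverse j)) (Mod-m.+-≈ʳ 1 (Mod-m.multiple-≈0 j))
  στ≈1 δ4    = Mod-m.≡⇒≈ refl
  στ≈1 from∞ = Mod-m.≡⇒≈ refl
  στ≈1 to∞   = Mod-m.≡⇒≈ refl

  module Labelling (o : Kind) = Mod-m.Affine (α o) (σ o) (τ o) (στ≈1 o)

  Base : Set
  Base = Fin 5 × Σ Family (Fin ∘ size)

  group : Base → Fin 3 → Fin 6
  group (i , f , _) r = rotate i (vertex f r)

  label : Base → Fin 3 → ℕ
  label (_ , f , x) r = Labelling.apply (kind f r) (arcStart (f , r) + toℕ x)

  raw : Family → ℕ → Fin 3 → ℕ
  raw f c r = α (kind f r) + σ (kind f r) * (arcStart (f , r) + c)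

  raw-sum : ∀ f (x : Fin (size f)) → ∃[ q ] raw f (toℕ x) 0F + raw f (toℕ x) 1F + raw f (toℕ x) 2F + 1 ≡ q * m
  raw-sum T113 x  = toℕ x + 2 , sum-T113 j (toℕ x)
  raw-sum T221 0F = 3 + 4 * j , sum-T221 j
  raw-sum T442 x  = toℕ x + 3 , sum-T442 j (toℕ x)
  raw-sum T∞2  x  = toℕ x + j + 3 , sum-T∞2 j (toℕ x)
  raw-sum T∞3  x  = toℕ x + j + 2 , sum-T∞3 j (toℕ x)
  raw-sum T∞4 0F  = 4 , sum-T∞4 j

  labels-sum : ∀ b → m ∣ label b 0F + label b 1F + label b 2F + 1
  labels-sum (_ , f , x) with raw-sum f x
  ... | q , eq = m%n≡0⇒n∣m _ m (Mod-m.mod-≡ (begin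
    label′ 0F + label′ 1F + label′ 2F + 1     ≈⟨ Mod-m.+-≈ˡ 1 (Mod-m.+-≈ (Mod-m.+-≈ (reduce 0F) (reduce 1F)) (reduce 2F)) ⟩
    raw′ 0F + raw′ 1F + raw′ 2F + 1           ≡⟨ eq ⟩
    q * m                                     ≈⟨ Mod-m.multiple-≈0 q ⟩
    0                                         ∎))
    where
    open import Relation.Binary.Reasoning.Setoid Mod-m.≈-setoid
    raw′ label′ : Fin 3 → ℕ
    raw′ = raw f (toℕ x)
    label′ r = raw′ r % m
    reduce : ∀ r → label′ r Mod-m.≈ raw′ r
    reduce r = Mod-m.%-≈ (raw′ r)

  place : Fin 5 → Σ ArcType (Fin ∘ arcSize) → Base × Fin 3
  place v ((f , r) , x) = (v ⊖ anchor f r , f , x) , r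

  arcOfKind : Kind → Fin 5 → ℕ → Base × Fin 3
  arcOfKind o v e = place v (locate (tiling o) (Labelling.unapply o e) z≤n (m%n<n (τ o * (e + Mod-m.neg (α o))) m))

  -- The arc from group a to group a′ with label e (an arbitrary value when a = a′).
  arcOf : Fin 6 → Fin 6 → ℕ → Base × Fin 3
  arcOf a a′ e = maybe′ (λ (o , v) → arcOfKind o v e) ((0F , T∞4 , 0F) , 0F) (classify a a′)

  arcOfKind-sound : ∀ o v e → e < m → ∀ {a a′} → arcEnds (o , v) ≡ (a , a′) →
                    let (b , r) = arcOfKind o v e in
                    group b r ≡ a × group b (next r) ≡ a′ × label b r ≡ e
  arcOfKind-sound o v e e<m ends
    with locate (tiling o) (Labelling.unapply o e) z≤n (m%n<n (τ o * (e + Mod-m.neg (α o))) m)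
       | locate-sound (tiling o) (Labelling.unapply o e) z≤n (m%n<n (τ o * (e + Mod-m.neg (α o))) m)
  ... | (f , r) , x | tile , c≡ = cong proj₁ ends′ , cong proj₂ ends′ , (begin
    Labelling.apply (kind f r) (arcStart (f , r) + toℕ x)   ≡⟨ cong₂ Labelling.apply kind≡ (sym c≡) ⟩
    Labelling.apply o (Labelling.unapply o e)              ≡⟨ Labelling.apply-unapply o e<m ⟩
    e                                                      ∎)
    where
    open ≡-Reasoning
    kind≡ : kind f r ≡ o
    kind≡ = All.lookup (tiles-kind o) tile
    ends′ : (rotate (v ⊖ anchor f r) (vertex f r) , rotate (v ⊖ anchor f r) (vertex f (next r))) ≡ _
    ends′ = trans (arc-at-anchor v f r) (trans (cong (λ o′ → arcEnds (o′ , v)) kind≡) ends)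

  arcOf-sound : ∀ a a′ e → a ≢ a′ → e < m →
                let (b , r) = arcOf a a′ e in
                group b r ≡ a × group b (next r) ≡ a′ × label b r ≡ e
  arcOf-sound a a′ e a≢a′ e<m with classify-sound a a′
  ... | inj₁ a≡a′ = ⊥-elim (a≢a′ a≡a′)
  ... | inj₂ ends with classify a a′
  ...   | just (o , v) = arcOfKind-sound o v e e<m (Maybe.just-injective ends)

  arcOf-arc : ∀ b r → arcOf (group b r) (group b (next r)) (label b r) ≡ (b , r)
  arcOf-arc (i , f , x) r = begin
    arcOf (group b r) (group b (next r)) e
      ≡⟨ cong (maybe′ (λ (o , v) → arcOfKind o v e) ((0F , T∞4 , 0F) , 0F)) (classify-arc i f r) ⟩
    place (i ⊕ anchor f r) (locate (tiling (kind f r)) (Labelling.unapply (kind f r) e) z≤n _)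
      ≡⟨ cong (place (i ⊕ anchor f r)) (locate-at (tiling (kind f r)) (tile∈ f r) x (Labelling.unapply-apply (kind f r) c<m)) ⟩
    place (i ⊕ anchor f r) ((f , r) , x)
      ≡⟨ cong (λ v → (v , f , x) , r) (⊕-⊖ i (anchor f r)) ⟩
    ((i , f , x) , r) ∎
    where
    open ≡-Reasoning
    b = (i , f , x)
    e = label b r
    c<m : arcStart (f , r) + toℕ x < m
    c<m = <-≤-trans (+-monoʳ-< (arcStart (f , r)) (Fin.toℕ<n x)) (proj₂ (tile-bounds (tiling (kind f r)) (tile∈ f r)))

  starter : Starter 6 m
  starter = record
    { Base             = Base
    ; bases            = finEnum 5 ×-enum Σ-enum families (finEnum ∘ size)
    ; group            = group
    ; label            = label
    ; corners-distinct = λ (i , f , _) r → arc-groups-differ i f r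
    ; label<m          = λ (_ , f , x) r → m%n<n (raw f (toℕ x) r) m
    ; labels-sum       = labels-sum
    ; arcOf            = arcOf
    ; arcOf-sound      = arcOf-sound
    ; arcOf-arc        = arcOf-arc
    }

odd-form : ∀ m → 3 ≤ m → m % 2 ≡ 1 → ∃[ j ] m ≡ suc (suc j + suc j)
odd-form m 3≤m m-odd with m / 2 | m≡m%n+[m/n]*n m 2
... | zero  | m≡ = ⊥-elim (3≰1 (subst (3 ≤_) (trans m≡ (cong (_+ 0) m-odd)) 3≤m))
  where
  3≰1 : ¬ 3 ≤ 1
  3≰1 (s≤s ())
... | suc j | m≡ = j , trans m≡ (trans (cong (_+ suc j * 2) m-odd) (double j))
  where
  double : ∀ j → 1 + suc j * 2 ≡ suc (suc j + suc j)
  double = solve-∀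

lemma3p7 : (m : ℕ) → 3 ≤ m → m % 2 ≡ 1 → Exists3SCHGDD 6 m 3
lemma3p7 m 3≤m m-odd with odd-form m 3≤m m-odd
... | j , refl = Development.development (Construction.starter j)
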